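{- Let $D$ be a 3-coloured tournament in which each vertex is incident with edges of at most two colours, such that $D$ contains no triple spanning a $T_3$ and no vertex that monochromatically dominates every other vertex, and which is minimal with respect to containment with these properties (i.e. every proper nonempty subtournament of $D$ contains a $T_3$ or a vertex monochromatically dominating all its other vertices within the subtournament). Then $D$ has a unique directed Hamilton cycle $C$ (up to rotation) such that each vertex monochromatically dominates every vertex except for its predecessor on $C$.
   Context: A 3-coloured tournament is a finite tournament each of whose edges is coloured red, blue or green. A triple of vertices spans a $T_3$ if the three edges between them form a directed cycle and have three distinct colours. For distinct vertices $x,y$, $x$ monochromatically dominates $y$ if there is a directed path from $x$ to $y$ all of whose edges have the same colour. -}

module Defs where

open import Data.Nat using (ℕ; zero; suc)
open import Data.Fin using (Fin)
open import Data.Fin.Subset using (Subset; _∈_; _∉_; ⊤; Nonempty)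
open import Data.List using (List; []; _∷_)
open import Data.List.Relation.Unary.Unique.Propositional using (Unique)
open import Data.Product using (Σ; ∃; ∃-syntax; _×_; _,_)
open import Data.Sum using (_⊎_)
open import Relation.Nullary using (¬_)
open import Relation.Binary.PropositionalEquality using (_≡_; _≢_)

data Colour : Set where
  red blue green : Colour

-- A 3-coloured tournament on vertex set Fin n.
-- x ⟶ y means the edge between x and y is directed from x to y;
-- colour x y is the colour of that arc (only meaningful when x ⟶ y).
record Tournament3 (n : ℕ) : Set₁ where
  field
    _⟶_     : Fin n → Fin n → Set
    irrefl  : ∀ x → ¬ (x ⟶ x)
    antisym : ∀ {x y} → x ⟶ y → ¬ (y ⟶ x)
    total   : ∀ x y → x ≢ y → (x ⟶ y) ⊎ (y ⟶ x)
    colour  : Fin n → Fin n → Colour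

module _ {n : ℕ} (D : Tournament3 n) where
  open Tournament3 D

  IncidentColour : Fin n → Colour → Set
  IncidentColour v c = ∃[ w ] ((v ⟶ w × colour v w ≡ c) ⊎ (w ⟶ v × colour w v ≡ c))

  AtMostTwoColoursAtEachVertex : Set
  AtMostTwoColoursAtEachVertex = ∀ v → ∃[ c ] ¬ IncidentColour v c

  SpansT3 : Subset n → Fin n → Fin n → Fin n → Set
  SpansT3 S x y z =
    x ∈ S × y ∈ S × z ∈ S ×
    x ⟶ y × y ⟶ z × z ⟶ x ×
    colour x y ≢ colour y z × colour y z ≢ colour z x × colour x y ≢ colour z x

  ContainsT3 : Subset n → Set
  ContainsT3 S = ∃[ x ] ∃[ y ] ∃[ z ] SpansT3 S x y z

  -- MonoWalk S c x y vs : vs is the vertex sequence of a directed walk from x to y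
  -- with at least one edge, all edges of colour c, all vertices in S.
  data MonoWalk (S : Subset n) (c : Colour) : Fin n → Fin n → List (Fin n) → Set where
    edge : ∀ {x y} → x ∈ S → y ∈ S → x ⟶ y → colour x y ≡ c →
           MonoWalk S c x y (x ∷ y ∷ [])
    cons : ∀ {x z y vs} → x ∈ S → x ⟶ z → colour x z ≡ c →
           MonoWalk S c z y vs → MonoWalk S c x y (x ∷ vs)

  MonoPath : Subset n → Colour → Fin n → Fin n → Set
  MonoPath S c x y = ∃[ vs ] (MonoWalk S c x y vs × Unique vs)

  MonoDominates : Subset n → Fin n → Fin n → Set
  MonoDominates S x y = ∃[ c ] MonoPath S c x y

  DominatesAll : Subset n → Fin n → Set
  DominatesAll S x = x ∈ S × (∀ y → y ∈ S → y ≢ x → MonoDominates S x y)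

  HasDominatingVertex : Subset n → Set
  HasDominatingVertex S = ∃[ x ] DominatesAll S x

  ProperNonempty : Subset n → Set
  ProperNonempty S = Nonempty S × ∃[ x ] x ∉ S

  MinimalCounterexample : Set
  MinimalCounterexample =
    AtMostTwoColoursAtEachVertex ×
    ¬ ContainsT3 ⊤ ×
    ¬ HasDominatingVertex ⊤ ×
    (∀ S → ProperNonempty S → ContainsT3 S ⊎ HasDominatingVertex S)

iter : ∀ {A : Set} → (A → A) → ℕ → A → A
iter f zero    a = a
iter f (suc k) a = f (iter f k a)

module _ {n : ℕ} (D : Tournament3 n) where
  open Tournament3 D

  -- A directed Hamilton cycle, given by its successor function s:
  -- every v ⟶ s v, and iterating s from any vertex reaches every vertex.
  -- (A cycle up to rotation is exactly its successor function.)
  HamiltonCycle : (Fin n → Fin n) → Set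
  HamiltonCycle s = (∀ v → v ⟶ s v) × (∀ u v → ∃[ k ] iter s k u ≡ v)

  -- each vertex x monochromatically dominates every vertex y other than its
  -- predecessor on the cycle (the predecessor y is the one with s y ≡ x)
  DominatesAllButPredecessor : (Fin n → Fin n) → Set
  DominatesAllButPredecessor s =
    ∀ x y → y ≢ x → s y ≢ x → MonoDominates D ⊤ x y

module Submission where

-- (1) For each vertex v the subtournament D − v is proper and nonempty (D has a
--     second vertex, since otherwise v would dominate everything vacuously) and
--     contains no T₃, so by minimality some vertex s v dominates all of D − v.
--     As no vertex dominates all of D, s v does not dominate v. Hence v ⟶ s v
--     (an arc is a monochromatic path) and s is injective.
-- (2) An injective endofunction of Fin n is a permutation: every point is
--     periodic, so its orbit is a decidable set closed under s.
-- (3) No proper nonempty set S is closed under s-predecessors, because a vertex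
--     s m dominating S would dominate m. The complement of an orbit is closed
--     under predecessors, so it is empty: s is a Hamilton cycle.
-- (4) If s′ also has the stated properties and s′ v ≢ s v, then v is not the
--     s′-predecessor of s v, so s v dominates v, which is impossible.

open import Defs
open import Data.Nat using (ℕ; zero; suc; _+_; _<_; s≤s; z<s)
open import Data.Nat.Properties using (n<1+n; +-suc; m≤n⇒∃[o]m+o≡n; m≤n⇒m<n∨m≡n; anyUpTo?)
open import Data.Fin using (Fin; toℕ; _≟_)
open import Data.Fin.Properties using (pigeonhole; any?)
open import Data.Fin.Subset using (Subset; _∈_; _⊆_; ⊤)
open import Data.Fin.Subset.Properties using (∈⊤; ⊆⊤)
open import Data.Vec using (tabulate)
open import Data.Vec.Properties using (lookup∘tabulate; lookup⇒[]=; []=⇒lookup)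
open import Data.List using ([]; _∷_)
open import Data.List.Relation.Unary.All using ([]; _∷_)
open import Data.List.Relation.Unary.AllPairs using ([]; _∷_)
open import Data.Product using (Σ; ∃-syntax; _×_; _,_; proj₁; proj₂)
open import Data.Sum using (_⊎_; inj₁; inj₂)
open import Data.Empty using (⊥-elim)
open import Function using (_∘_)
open import Function.Definitions using (Injective)
open import Relation.Nullary using (¬_; yes; no; does; ¬?)
open import Relation.Nullary.Decidable using (dec-true)
open import Relation.Unary using (Decidable)
open import Relation.Binary.PropositionalEquality
  using (_≡_; _≢_; refl; sym; trans; cong; subst; module ≡-Reasoning)

module _ {n : ℕ} {P : Fin n → Set} (P? : Decidable P) where

  subsetOf : Subset n
  subsetOf = tabulate (λ x → does (P? x))

  ∈subsetOf⁺ : ∀ {x} → P x → x ∈ subsetOf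
  ∈subsetOf⁺ {x} p = lookup⇒[]= x subsetOf (trans (lookup∘tabulate _ x) (dec-true (P? x) p))

  ∈subsetOf⁻ : ∀ {x} → x ∈ subsetOf → P x
  ∈subsetOf⁻ {x} x∈ with P? x | trans (sym (lookup∘tabulate (λ y → does (P? y)) x)) ([]=⇒lookup x∈)
  ... | yes p | _ = p
  ... | no _  | ()

iter-+ : ∀ {A : Set} (f : A → A) a b x → iter f (a + b) x ≡ iter f a (iter f b x)
iter-+ f zero    b x = refl
iter-+ f (suc a) b x = cong f (iter-+ f a b x)

module Orbits {n : ℕ} (f : Fin n → Fin n) (f-injective : Injective _≡_ _≡_ f) where

  iter-injective : ∀ k {x y} → iter f k x ≡ iter f k y → x ≡ y
  iter-injective zero    eq = eq
  iter-injective (suc k) eq = iter-injective k (f-injective eq)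

  -- Every point is periodic: among u, f u, …, fⁿ u two coincide (pigeonhole),
  -- and injectivity cancels the common prefix of iterations.
  periodic : ∀ u → ∃[ e ] iter f (suc e) u ≡ u
  periodic u with pigeonhole (n<1+n n) (λ i → iter f (toℕ i) u)
  ... | i , j , i<j , same with m≤n⇒∃[o]m+o≡n i<j
  ...   | e , i+1+e≡j = e , sym (iter-injective (toℕ i) (begin
          iter f (toℕ i) u                  ≡⟨ same ⟩
          iter f (toℕ j) u                  ≡⟨ cong (λ k → iter f k u) j≡i+1+e ⟩
          iter f (toℕ i + suc e) u          ≡⟨ iter-+ f (toℕ i) (suc e) u ⟩
          iter f (toℕ i) (iter f (suc e) u) ∎))
    where
    open ≡-Reasoning
    j≡i+1+e : toℕ j ≡ toℕ i + suc e
    j≡i+1+e = trans (sym i+1+e≡j) (sym (+-suc (toℕ i) e))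

  period : Fin n → ℕ
  period u = proj₁ (periodic u)

  returns : ∀ u → iter f (suc (period u)) u ≡ u
  returns u = proj₂ (periodic u)

  -- f is surjective: the predecessor of w is its period-th iterate.
  surjective : ∀ w → ∃[ m ] f m ≡ w
  surjective w = iter f (period w) w , returns w

  InOrbit : Fin n → Fin n → Set
  InOrbit u w = ∃[ k ] (k < suc (period u) × iter f k u ≡ w)

  inOrbit? : ∀ u → Decidable (InOrbit u)
  inOrbit? u w = anyUpTo? (λ k → iter f k u ≟ w) (suc (period u))

  orbit-start : ∀ u → InOrbit u u
  orbit-start u = 0 , z<s , refl

  -- Orbits are closed under f: the step after the last listed iterate is u.
  orbit-step : ∀ {u w} → InOrbit u w → InOrbit u (f w)
  orbit-step {u} (k , s≤s k≤e , refl) with m≤n⇒m<n∨m≡n k≤e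
  ... | inj₁ k<e  = suc k , s≤s k<e , refl
  ... | inj₂ refl = 0 , z<s , sym (returns u)

module _ {n : ℕ} (D : Tournament3 n) where
  open Tournament3 D

  walk-mono : ∀ {S T c x y vs} → S ⊆ T → MonoWalk D S c x y vs → MonoWalk D T c x y vs
  walk-mono S⊆T (edge x∈ y∈ e c) = edge (S⊆T x∈) (S⊆T y∈) e c
  walk-mono S⊆T (cons x∈ e c w)  = cons (S⊆T x∈) e c (walk-mono S⊆T w)

  dominates-mono : ∀ {S T x y} → S ⊆ T → MonoDominates D S x y → MonoDominates D T x y
  dominates-mono S⊆T (c , vs , w , u) = c , vs , walk-mono S⊆T w , u

  T3-mono : ∀ {S T} → S ⊆ T → ContainsT3 D S → ContainsT3 D T
  T3-mono S⊆T (x , y , z , x∈ , y∈ , z∈ , cycle) = x , y , z , S⊆T x∈ , S⊆T y∈ , S⊆T z∈ , cycle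

  arc-dominates : ∀ {S x y} → x ∈ S → y ∈ S → x ⟶ y → MonoDominates D S x y
  arc-dominates {x = x} {y} x∈ y∈ e =
    colour x y , (x ∷ y ∷ []) , edge x∈ y∈ e refl , (x≢y ∷ []) ∷ [] ∷ []
    where
    x≢y : x ≢ y
    x≢y refl = irrefl x e

module MinimalCounterexampleFacts {n : ℕ} (D : Tournament3 n) (mc : MinimalCounterexample D) where
  open Tournament3 D

  private
    noT3 : ¬ ContainsT3 D ⊤
    noT3 = proj₁ (proj₂ mc)

    noDominatingVertex : ¬ HasDominatingVertex D ⊤
    noDominatingVertex = proj₁ (proj₂ (proj₂ mc))

    minimal : ∀ S → ProperNonempty D S → ContainsT3 D S ⊎ HasDominatingVertex D S
    minimal = proj₂ (proj₂ (proj₂ mc))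

  dominator : ∀ S → ProperNonempty D S → HasDominatingVertex D S
  dominator S S-proper with minimal S S-proper
  ... | inj₁ t3  = ⊥-elim (noT3 (T3-mono D ⊆⊤ t3))
  ... | inj₂ dom = dom

  misses : ∀ w v → (∀ y → y ≢ v → y ≢ w → MonoDominates D ⊤ w y) → ¬ MonoDominates D ⊤ w v
  misses w v dominates-rest w→v = noDominatingVertex (w , ∈⊤ , dominates-all)
    where
    dominates-all : ∀ y → y ∈ ⊤ → y ≢ w → MonoDominates D ⊤ w y
    dominates-all y _ y≢w with y ≟ v
    ... | yes refl = w→v
    ... | no y≢v   = dominates-rest y y≢v y≢w

  differs? : (v : Fin n) → Decidable (λ w → w ≢ v)
  differs? v w = ¬? (w ≟ v)

  -- D has at least two vertices: a lone vertex would dominate all others.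
  other-vertex : ∀ v → ∃[ w ] w ≢ v
  other-vertex v with any? (differs? v)
  ... | yes found = found
  ... | no none   = ⊥-elim (noDominatingVertex (v , ∈⊤ , λ y _ y≢v → ⊥-elim (none (y , y≢v))))

  allBut : Fin n → Subset n
  allBut v = subsetOf (differs? v)

  allBut-proper : ∀ v → ProperNonempty D (allBut v)
  allBut-proper v with other-vertex v
  ... | w , w≢v = (w , ∈subsetOf⁺ (differs? v) w≢v) , v , λ v∈ → ∈subsetOf⁻ (differs? v) v∈ refl

  succ : Fin n → Fin n
  succ v = proj₁ (dominator (allBut v) (allBut-proper v))

  succ-dominates-allBut : ∀ v → DominatesAll D (allBut v) (succ v)
  succ-dominates-allBut v = proj₂ (dominator (allBut v) (allBut-proper v))

  succ≢ : ∀ v → succ v ≢ v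
  succ≢ v = ∈subsetOf⁻ (differs? v) (proj₁ (succ-dominates-allBut v))

  succ-dominates : ∀ v y → y ≢ v → y ≢ succ v → MonoDominates D ⊤ (succ v) y
  succ-dominates v y y≢v y≢s =
    dominates-mono D ⊆⊤ (proj₂ (succ-dominates-allBut v) y (∈subsetOf⁺ (differs? v) y≢v) y≢s)

  succ-misses : ∀ v → ¬ MonoDominates D ⊤ (succ v) v
  succ-misses v = misses (succ v) v (succ-dominates v)

  -- The arc between v and succ v points forward, else succ v would dominate v.
  arc-to-succ : ∀ v → v ⟶ succ v
  arc-to-succ v with total v (succ v) (succ≢ v ∘ sym)
  ... | inj₁ forward  = forward
  ... | inj₂ backward = ⊥-elim (succ-misses v (arc-dominates D ∈⊤ ∈⊤ backward))

  -- If succ v ≡ succ w with v ≢ w, then succ w = succ v would dominate w.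
  succ-injective : Injective _≡_ _≡_ succ
  succ-injective {v} {w} same with v ≟ w
  ... | yes v≡w = v≡w
  ... | no v≢w  = ⊥-elim (succ-misses w (subst (λ z → MonoDominates D ⊤ z w) same
          (succ-dominates v w (v≢w ∘ sym) λ w≡sv → succ≢ w (trans (sym same) (sym w≡sv)))))

  open Orbits succ succ-injective

  -- No proper nonempty set is closed under predecessors: its dominating vertex
  -- succ m would have its predecessor m in the set, and so dominate m.
  not-predecessor-closed : ∀ S → ProperNonempty D S → ¬ (∀ m → succ m ∈ S → m ∈ S)
  not-predecessor-closed S S-proper closed with dominator S S-proper
  ... | w , w∈ , dominates with surjective w
  ...   | m , refl = succ-misses m (dominates-mono D ⊆⊤ (dominates m (closed m w∈) (succ≢ m ∘ sym)))

  -- Every orbit is everything: the complement of an orbit is closed under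
  -- predecessors and misses its starting point.
  hamiltonian : HamiltonCycle D succ
  hamiltonian = arc-to-succ , reaches
    where
    reaches : ∀ u v → ∃[ k ] iter succ k u ≡ v
    reaches u v with inOrbit? u v
    ... | yes (k , _ , reached) = k , reached
    ... | no v∉ = ⊥-elim (not-predecessor-closed outside outside-proper outside-closed)
      where
      outsideOrbit? : Decidable (λ w → ¬ InOrbit u w)
      outsideOrbit? w = ¬? (inOrbit? u w)

      outside : Subset n
      outside = subsetOf outsideOrbit?

      outside-proper : ProperNonempty D outside
      outside-proper = (v , ∈subsetOf⁺ outsideOrbit? v∉) ,
        u , λ u∈ → ∈subsetOf⁻ outsideOrbit? u∈ (orbit-start u)

      outside-closed : ∀ m → succ m ∈ outside → m ∈ outside
      outside-closed m sm∈ = ∈subsetOf⁺ outsideOrbit?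
        (∈subsetOf⁻ outsideOrbit? sm∈ ∘ orbit-step)

  -- x = succ m dominates everything except m and itself, and m is its predecessor.
  dominates-all-but-predecessor : DominatesAllButPredecessor D succ
  dominates-all-but-predecessor x y y≢x sy≢x with surjective x
  ... | m , refl = succ-dominates m y (sy≢x ∘ cong succ) y≢x

  -- A competing s′ must agree with succ, since otherwise succ v would dominate v.
  unique : ∀ s′ → HamiltonCycle D s′ → DominatesAllButPredecessor D s′ → ∀ v → s′ v ≡ succ v
  unique s′ _ dominates′ v with s′ v ≟ succ v
  ... | yes agree = agree
  ... | no differ = ⊥-elim (succ-misses v (dominates′ (succ v) v (succ≢ v ∘ sym) differ))

corollary2p2 : ∀ {n : ℕ} (D : Tournament3 n) → MinimalCounterexample D →
    Σ (Fin n → Fin n) (λ s →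
      HamiltonCycle D s × DominatesAllButPredecessor D s ×
      (∀ s′ → HamiltonCycle D s′ → DominatesAllButPredecessor D s′ → ∀ v → s′ v ≡ s v))
corollary2p2 D mc = succ , hamiltonian , dominates-all-but-predecessor , unique
  where open MinimalCounterexampleFacts D mc
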